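{- Let $k,n\in\mathbb{N}$ with $k<n$ and let $T$ be the set of words over $\{v_{1},\dots,v_{k}\}$ in which $v_{i}$ occurs for each $i\in\{1,\dots,k\}$. For $w\in S_{n}$ let $\tau(w)\in T$ be obtained from $w$ by deleting all occurrences of elements of $\mathbb{A}$ as well as all occurrences of $v_{i}$ for $k<i\leq n$. Let $\langle y_{t}\rangle_{t=1}^{\infty}$ be a sequence in $T$ and let $C\subseteq S_{0}$ be a $C$-set in $(S_0,\cdot)$. Then there exists a sequence $\langle w_{t}\rangle_{t=1}^{\infty}$ in $S_{n}$ such that $\{w_{m}(\vec{a}):\vec{a}\in\mathbb{A}_{m}^{n}\}\subseteq C$ for all $m\in\mathbb{N}$, and for every finite nonempty $G=\{m_{1}<m_{2}<\cdots<m_{l}\}\subseteq\mathbb{N}$, \[ \tau(w_{m_{1}})\tau(w_{m_{2}})\cdots\tau(w_{m_{l}})\in\mathrm{FP}(\langle y_{t}\rangle_{t=1}^{\infty}). \]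
   Context: Let $\mathbb{A}_{1}\subseteq\mathbb{A}_{2}\subseteq\cdots$ be an increasing sequence of finite nonempty alphabets and $\mathbb{A}=\bigcup_{i}\mathbb{A}_{i}$. $S_{0}$ is the set of all nonempty finite words over $\mathbb{A}$, a semigroup under concatenation. $v_{1},\dots,v_{n}$ are distinct variables not in $\mathbb{A}$; $S_{n}$ is the set of words over $\mathbb{A}\cup\{v_{1},\dots,v_{n}\}$ in which each $v_{i}$ occurs at least once. For $w\in S_{n}$ and $\vec{a}=(a_{1},\dots,a_{n})\in\mathbb{A}^{n}$, $w(\vec{a})$ is obtained by replacing each occurrence of $v_{i}$ by $a_{i}$. Products in $T$ are concatenations, and $\mathrm{FP}(\langle y_{t}\rangle)=\{y_{t_{1}}\cdots y_{t_{r}}:r\in\mathbb{N},\ t_{1}<\cdots<t_{r}\}$. For a semigroup $S$, $B\subseteq S$ is a $J$-set if for every finite nonempty set $F$ of sequences $f:\mathbb{N}\to S$ there exist $m\in\mathbb{N}$, $a_{1},\dots,a_{m+1}\in S$ and $t_{1}<\cdots<t_{m}$ with $a_{1}f(t_{1})\cdots a_{m}f(t_{m})a_{m+1}\in B$ for all $f\in F$; $J(S)$ is the set of $p\in\beta S$ all of whose members are $J$-sets; $B$ is a $C$-set if $B\in p$ for some idempotent $p\in J(S)$. -}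

module Defs where

open import Level using (Level)
open import Data.Nat using (ℕ; suc; _<_; _<?_)
open import Data.Fin using (Fin; toℕ; fromℕ<)
open import Data.Sum using (_⊎_; inj₁; inj₂)
open import Data.Product using (Σ; ∃; ∃-syntax; _×_; _,_; proj₁; proj₂)
open import Data.Maybe using (Maybe; just; nothing)
open import Data.Empty using (⊥)
open import Data.List using (List; []; _∷_; mapMaybe; concat; map)
open import Data.List.NonEmpty using (List⁺; toList) renaming (map to map⁺)
open import Data.List.Relation.Unary.All using (All)
open import Data.List.Relation.Unary.Linked using (Linked)
open import Data.List.Membership.Propositional using (_∈_)
open import Relation.Nullary using (¬_; yes; no)
open import Function using (id)
open import Function.Bundles using (_⇔_)

module SemigroupNotions {S : Set} (_∙_ : S → S → S) where

  -- a₁ f(t₁) a₂ f(t₂) ⋯ aₘ f(tₘ) aₘ₊₁ , where ps = [(a₁,t₁),…,(aₘ,tₘ)]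
  -- and last = aₘ₊₁
  jProd : (ℕ → S) → List (S × ℕ) → S → S
  jProd f []             last = last
  jProd f ((a , t) ∷ ps) last = a ∙ (f t ∙ jProd f ps last)

  JSet : (S → Set) → Set
  JSet B = (F : List⁺ (ℕ → S)) →
    Σ (List⁺ (S × ℕ)) λ ps → Σ S λ last →
      Linked _<_ (map proj₂ (toList ps)) ×
      All (λ f → B (jProd f (toList ps) last)) (toList F)

  record Ultrafilter : Set₁ where
    field
      mem      : (S → Set) → Set
      upward   : (A B : S → Set) → (∀ x → A x → B x) → mem A → mem B
      inter    : (A B : S → Set) → mem A → mem B → mem (λ x → A x × B x)
      noEmpty  : ¬ mem (λ _ → ⊥)
      ultra    : (A : S → Set) → mem A ⊎ mem (λ x → ¬ A x)
  open Ultrafilter public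

  memProd : Ultrafilter → Ultrafilter → (S → Set) → Set
  memProd p q A = mem p (λ x → mem q (λ y → A (x ∙ y)))

  Idempotent : Ultrafilter → Set₁
  Idempotent p = (A : S → Set) → mem p A ⇔ memProd p p A

  InJ : Ultrafilter → Set₁
  InJ p = (A : S → Set) → mem p A → JSet A

  CSet : (S → Set) → Set₁
  CSet B = Σ Ultrafilter λ p → Idempotent p × InJ p × mem p B

module Words (Alph : Set) where

  S₀ : Set
  S₀ = List⁺ Alph

  -- S_n : nonempty words over 𝔸 ∪ {v₁,…,vₙ} (variable vᵢ₊₁ is inj₂ i)
  -- in which each variable occurs.
  Sn : ℕ → Set
  Sn n = Σ (List⁺ (Alph ⊎ Fin n)) λ u → (i : Fin n) → inj₂ i ∈ toList u

  subst : {n : ℕ} → Sn n → (Fin n → Alph) → S₀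
  subst (u , _) a = map⁺ (λ { (inj₁ x) → x ; (inj₂ i) → a i }) u

  T : ℕ → Set
  T k = Σ (List (Fin k)) λ u → (i : Fin k) → i ∈ u

  tauLetter : {n : ℕ} (k : ℕ) → Alph ⊎ Fin n → Maybe (Fin k)
  tauLetter k (inj₁ _) = nothing
  tauLetter k (inj₂ i) with toℕ i <? k
  ... | yes p = just (fromℕ< p)
  ... | no _  = nothing

  τ : {n : ℕ} (k : ℕ) → Sn n → List (Fin k)
  τ k (u , _) = mapMaybe (tauLetter k) (toList u)

  FP : {k : ℕ} → (ℕ → T k) → List (Fin k) → Set
  FP y x = Σ (List⁺ ℕ) λ ts →
    Linked _<_ (toList ts) × x ≡ concat (map (λ t → proj₁ (y t)) (toList ts))
    where open import Relation.Binary.PropositionalEquality using (_≡_)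

-- Let z_t = v_{k+1} ⋯ v_n y_t; it contains every variable
-- and τ(z_t) = y_t.  For the m-th word apply the J-set property to the
-- finitely many sequences t ↦ z_{t+N}(a⃗), a⃗ ∈ 𝔸_m^n: it yields b₁,…,b_{r+1}
-- and t₁ < ⋯ < t_r with b₁ z_{t₁+N}(a⃗) ⋯ b_r z_{t_r+N}(a⃗) b_{r+1} ∈ C for
-- all a⃗, so w_m = b₁ z_{t₁+N} ⋯ b_r z_{t_r+N} b_{r+1} satisfies w_m(a⃗) ∈ C
-- and τ(w_m) = y_{t₁+N} ⋯ y_{t_r+N}.  Taking the offset N above every index
-- used for w₁,…,w_{m-1} makes the index blocks of successive words increase,
-- so τ(w_{m₁}) ⋯ τ(w_{m_l}) ∈ FP(⟨y_t⟩).
module Submission where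

open import Defs
open import Data.Nat using (ℕ; zero; suc; _+_; _<_; _≤_; _<?_; s≤s; _≤′_; ≤′-refl; ≤′-step)
open import Data.Nat.Properties
  using (≤-refl; ≤-trans; <-trans; <-≤-trans; ≤⇒≤′; n≤1+n; n≮n; m≤n+m; <⇒≤; +-monoˡ-<)
open import Data.Fin using (Fin; toℕ; fromℕ<; inject≤) renaming (zero to fzero; suc to fsuc)
open import Data.Fin.Properties using (toℕ-injective; toℕ-inject≤; toℕ-fromℕ<; fromℕ<-toℕ; fromℕ<-cong; toℕ<n)
open import Data.Vec.Functional using (Vector; head; tail) renaming (_∷_ to _∷ᵛ_)
open import Data.Product using (Σ; _×_; _,_; proj₁; proj₂)
open import Data.Sum using (_⊎_; inj₁; inj₂; [_,_]′)
open import Data.Maybe using (Maybe; just; nothing)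
open import Data.Empty using (⊥-elim)
open import Data.List using (List; []; _∷_; _++_; [_]; map; concat; mapMaybe; filter; allFin; cartesianProductWith)
import Data.List.Properties as List
open import Data.List.NonEmpty using (List⁺; _∷_; toList; _⁺++_; _⁺++⁺_) renaming (map to map⁺)
import Data.List.NonEmpty.Properties as List⁺
open import Data.List.Extrema.Nat using (max; ⊥≤max; xs≤max)
open import Data.List.Membership.Propositional using (_∈_)
open import Data.List.Membership.Propositional.Properties
  using (∈-map⁺; ∈-++⁺ˡ; ∈-++⁺ʳ; ∈-filter⁺; ∈-allFin; ∈-cartesianProductWith⁺)
open import Data.List.Relation.Unary.Any using (here; there)
open import Data.List.Relation.Unary.All as All using (All; []; _∷_)
import Data.List.Relation.Unary.All.Properties as All
import Data.List.Relation.Unary.AllPairs as AllPairs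
import Data.List.Relation.Unary.AllPairs.Properties as AllPairs
open import Data.List.Relation.Unary.Linked as Linked using (Linked)
import Data.List.Relation.Unary.Linked.Properties as Linked
open import Relation.Nullary using (¬_; yes; no; ¬?)
open import Relation.Binary.PropositionalEquality
  using (_≡_; refl; sym; trans; cong; cong₂; subst; module ≡-Reasoning)
open import Function using (id; _∘_; const)

mapMaybe-≡[] : {A B : Set} (f : A → Maybe B) {xs : List A} →
  All (λ x → f x ≡ nothing) xs → mapMaybe f xs ≡ []
mapMaybe-≡[] f []                          = refl
mapMaybe-≡[] f {x ∷ _} (fx≡nothing ∷ rest) rewrite fx≡nothing = mapMaybe-≡[] f rest

allVectors : {A : Set} → List A → (m : ℕ) → List (Vector A m)
allVectors L zero    = [ (λ ()) ]
allVectors L (suc m) = cartesianProductWith _∷ᵛ_ L (allVectors L m)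

allVectors-complete : {A : Set} (L : List A) (m : ℕ) (a : Vector A m) → (∀ i → a i ∈ L) →
  Σ (Vector A m) λ b → b ∈ allVectors L m × (∀ i → b i ≡ a i)
allVectors-complete L zero    a _  = (λ ()) , here refl , λ ()
allVectors-complete L (suc m) a a∈L
  with b , b∈ , b≗ ← allVectors-complete L m (tail a) (a∈L ∘ fsuc) =
  head a ∷ᵛ b , ∈-cartesianProductWith⁺ _∷ᵛ_ (a∈L fzero) b∈ , λ { fzero → refl ; (fsuc i) → b≗ i }

module _ (blocks : ℕ → List ℕ) (bound : ℕ → ℕ)
  (bound-step : ∀ m → bound m ≤ bound (suc m))
  (blocks-increasing : ∀ m → Linked _<_ (blocks m))
  (blocks-above : ∀ m → All (bound m ≤_) (blocks m))
  (blocks-below : ∀ m → All (_< bound (suc m)) (blocks m)) where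

  bound-mono : ∀ {m m′} → m ≤′ m′ → bound m ≤ bound m′
  bound-mono ≤′-refl     = ≤-refl
  bound-mono (≤′-step p) = ≤-trans (bound-mono p) (bound-step _)

  blocks-separated : ∀ {m m′} → m < m′ → All (λ x → All (x <_) (blocks m′)) (blocks m)
  blocks-separated m<m′ = All.map (λ x<b → All.map (λ b≤x′ → <-≤-trans x<b (≤-trans (bound-mono (≤⇒≤′ m<m′)) b≤x′))
                                                   (blocks-above _))
                                  (blocks-below _)

  concat-blocks-increasing : ∀ {G} → Linked _<_ G → Linked _<_ (concat (map blocks G))
  concat-blocks-increasing G↑ = Linked.AllPairs⇒Linked (AllPairs.concat⁺
    (All.map⁺ (All.universal (λ m → Linked.Linked⇒AllPairs <-trans (blocks-increasing m)) _))
    (AllPairs.map⁺ (AllPairs.map blocks-separated (Linked.Linked⇒AllPairs <-trans G↑))))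

module Construction (Alph : Set) {k n : ℕ} (k<n : k < n) (y : ℕ → Words.T Alph k) where
  open Words Alph renaming (subst to substitute)

  Letter : Set
  Letter = Alph ⊎ Fin n

  lift : S₀ → List⁺ Letter
  lift = map⁺ inj₁

  assign : Vector Alph n → List⁺ Letter → S₀
  assign a = map⁺ [ id , a ]′

  erase : List⁺ Letter → List (Fin k)
  erase = mapMaybe (tauLetter k) ∘ toList

  substitute≡assign : (w : Sn n) (a : Vector Alph n) → substitute w a ≡ assign a (proj₁ w)
  substitute≡assign (u , _) a = List⁺.map-cong (λ { (inj₁ _) → refl ; (inj₂ _) → refl }) u

  assign-lift : (a : Vector Alph n) (b : S₀) → assign a (lift b) ≡ b
  assign-lift a b = trans (sym (List⁺.map-∘ b)) (List⁺.map-id b)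

  assign-cong : {a b : Vector Alph n} → (∀ i → a i ≡ b i) → (u : List⁺ Letter) → assign a u ≡ assign b u
  assign-cong a≗b = List⁺.map-cong λ { (inj₁ _) → refl ; (inj₂ i) → a≗b i }

  erase-lift : (b : S₀) → erase (lift b) ≡ []
  erase-lift b = trans (List.mapMaybe-map (tauLetter k) inj₁ (toList b)) (List.mapMaybe-nothing (toList b))

  erase-⁺++⁺ : (u v : List⁺ Letter) → erase (u ⁺++⁺ v) ≡ erase u ++ erase v
  erase-⁺++⁺ u v = List.mapMaybe-++ (tauLetter k) (toList u) (toList v)

  inject : Fin k → Fin n
  inject j = inject≤ j (<⇒≤ k<n)

  inject-fromℕ< : (i : Fin n) (i<k : toℕ i < k) → inject (fromℕ< i<k) ≡ i
  inject-fromℕ< i i<k = toℕ-injective (trans (toℕ-inject≤ _ _) (toℕ-fromℕ< i<k))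

  tauLetter-inject : (j : Fin k) → tauLetter k (inj₂ (inject j)) ≡ just j
  tauLetter-inject j with toℕ (inject j) <? k
  ... | yes p = cong just (trans (fromℕ<-cong _ _ (toℕ-inject≤ j _) p (toℕ<n j)) (fromℕ<-toℕ j _))
  ... | no ¬p = ⊥-elim (¬p (subst (_< k) (sym (toℕ-inject≤ j _)) (toℕ<n j)))

  tauLetter-large : (i : Fin n) → ¬ toℕ i < k → tauLetter k (inj₂ i) ≡ nothing
  tauLetter-large i ¬i<k with toℕ i <? k
  ... | yes i<k = ⊥-elim (¬i<k i<k)
  ... | no _    = refl

  -- v_{k+1}, …, v_n, with v_{k+1} repeated in front so that the list is visibly nonempty.
  largeVariables : List⁺ (Fin n)
  largeVariables = fromℕ< k<n ∷ filter (λ i → ¬? (toℕ i <? k)) (allFin n)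

  largeVariables-erased : All (λ i → tauLetter k (inj₂ i) ≡ nothing) (toList largeVariables)
  largeVariables-erased =
    tauLetter-large _ (λ k<k → n≮n k (subst (_< k) (toℕ-fromℕ< k<n) k<k))
    ∷ All.map (tauLetter-large _) (All.all-filter (λ i → ¬? (toℕ i <? k)) (allFin n))

  block : ℕ → List⁺ Letter
  block t = map⁺ inj₂ largeVariables ⁺++ map (inj₂ ∘ inject) (proj₁ (y t))

  erase-block : (t : ℕ) → erase (block t) ≡ proj₁ (y t)
  erase-block t = begin
    erase (block t)
      ≡⟨ List.mapMaybe-++ (tauLetter k) (map inj₂ (toList largeVariables)) (map (inj₂ ∘ inject) (proj₁ (y t))) ⟩
    mapMaybe (tauLetter k) (map inj₂ (toList largeVariables))
      ++ mapMaybe (tauLetter k) (map (inj₂ ∘ inject) (proj₁ (y t)))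
      ≡⟨ cong₂ _++_ (trans (List.mapMaybe-map (tauLetter k) inj₂ (toList largeVariables))
                           (mapMaybe-≡[] _ largeVariables-erased))
                    (List.mapMaybe-map-retract tauLetter-inject (proj₁ (y t))) ⟩
    proj₁ (y t) ∎
    where open ≡-Reasoning

  block-covers : (t : ℕ) (i : Fin n) → inj₂ i ∈ toList (block t)
  block-covers t i with toℕ i <? k
  ... | yes i<k = ∈-++⁺ʳ (map inj₂ (toList largeVariables))
    (subst (λ j → inj₂ j ∈ map (inj₂ ∘ inject) (proj₁ (y t))) (inject-fromℕ< i i<k)
           (∈-map⁺ (inj₂ ∘ inject) (proj₂ (y t) (fromℕ< i<k))))
  ... | no ¬i<k = ∈-++⁺ˡ (there (∈-map⁺ inj₂ (∈-filter⁺ (λ i → ¬? (toℕ i <? k)) (∈-allFin i) ¬i<k)))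

  shifted : ℕ → ℕ → List⁺ Letter
  shifted N t = block (t + N)

  template : (ℕ → List⁺ Letter) → List (S₀ × ℕ) → S₀ → List⁺ Letter
  template z []             last = lift last
  template z ((b , t) ∷ ps) last = lift b ⁺++⁺ (z t ⁺++⁺ template z ps last)

  open SemigroupNotions (_⁺++⁺_ {A = Alph}) using (jProd; JSet)

  assign-template : (a : Vector Alph n) (z : ℕ → List⁺ Letter) (ps : List (S₀ × ℕ)) (last : S₀) →
    assign a (template z ps last) ≡ jProd (assign a ∘ z) ps last
  assign-template a z []             last = assign-lift a last
  assign-template a z ((b , t) ∷ ps) last = begin
    assign a (lift b ⁺++⁺ (z t ⁺++⁺ template z ps last))
      ≡⟨ List⁺.map-⁺++⁺ [ id , a ]′ (lift b) _ ⟩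
    assign a (lift b) ⁺++⁺ assign a (z t ⁺++⁺ template z ps last)
      ≡⟨ cong₂ _⁺++⁺_ (assign-lift a b) (List⁺.map-⁺++⁺ [ id , a ]′ (z t) _) ⟩
    b ⁺++⁺ (assign a (z t) ⁺++⁺ assign a (template z ps last))
      ≡⟨ cong (λ rest → b ⁺++⁺ (assign a (z t) ⁺++⁺ rest)) (assign-template a z ps last) ⟩
    jProd (assign a ∘ z) ((b , t) ∷ ps) last ∎
    where open ≡-Reasoning

  erase-template : (z : ℕ → List⁺ Letter) (ps : List (S₀ × ℕ)) (last : S₀) →
    erase (template z ps last) ≡ concat (map (erase ∘ z) (map proj₂ ps))
  erase-template z []             last = erase-lift last
  erase-template z ((b , t) ∷ ps) last = begin
    erase (lift b ⁺++⁺ (z t ⁺++⁺ template z ps last))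
      ≡⟨ erase-⁺++⁺ (lift b) _ ⟩
    erase (lift b) ++ erase (z t ⁺++⁺ template z ps last)
      ≡⟨ cong₂ _++_ (erase-lift b) (erase-⁺++⁺ (z t) _) ⟩
    erase (z t) ++ erase (template z ps last)
      ≡⟨ cong (erase (z t) ++_) (erase-template z ps last) ⟩
    concat (map (erase ∘ z) (map proj₂ ((b , t) ∷ ps))) ∎
    where open ≡-Reasoning

  module Stages (C : S₀ → Set) (C-isJ : JSet C) where

    record Stage (L : List Alph) (N : ℕ) : Set where
      field
        word       : Sn n
        indices    : List⁺ ℕ
        word-in-C  : (a : Vector Alph n) → (∀ i → a i ∈ L) → C (substitute word a)
        τ-word     : τ k word ≡ concat (map (proj₁ ∘ y) (toList indices))
        increasing : Linked _<_ (toList indices)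
        above      : All (N ≤_) (toList indices)

    -- The constant sequence in front only serves to make the family nonempty.
    stage : (L : List Alph) → Alph → (N : ℕ) → Stage L N
    stage L x₀ N with C-isJ ((λ t → assign (const x₀) (shifted N t)) ∷ map (λ a → assign a ∘ shifted N) (allVectors L n))
    ... | ps@((b , t) ∷ _) , last , t↑ , in-C = record
      { word       = w
      ; indices    = map⁺ (_+ N) (map⁺ proj₂ ps)
      ; word-in-C  = w-in-C
      ; τ-word     = trans (erase-template (shifted N) (toList ps) last)
                           (cong concat (trans (List.map-cong (erase-block ∘ (_+ N)) (map proj₂ (toList ps)))
                                               (List.map-∘ (map proj₂ (toList ps)))))
      ; increasing = Linked.map⁺ {f = _+ N} (Linked.map (+-monoˡ-< N) t↑)
      ; above      = All.map⁺ (All.universal (m≤n+m N) (map proj₂ (toList ps)))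
      }
      where
      w : Sn n
      w = template (shifted N) (toList ps) last ,
          λ i → ∈-++⁺ʳ (toList (lift b)) (∈-++⁺ˡ (block-covers (t + N) i))

      w-in-C : (a : Vector Alph n) → (∀ i → a i ∈ L) → C (substitute w a)
      w-in-C a a∈L with a′ , a′∈ , a′≗a ← allVectors-complete L n a a∈L =
        subst C (begin
          jProd (assign a′ ∘ shifted N) (toList ps) last ≡⟨ assign-template a′ (shifted N) (toList ps) last ⟨
          assign a′ (proj₁ w)                            ≡⟨ assign-cong a′≗a (proj₁ w) ⟩
          assign a (proj₁ w)                             ≡⟨ substitute≡assign w a ⟨
          substitute w a                                 ∎)
          (All.lookup (All.map⁻ (All.tail in-C)) a′∈)
        where open ≡-Reasoning

    module Sequence (L : ℕ → List Alph) (x₀ : ℕ → Alph) where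

      bound  : ℕ → ℕ
      stages : (m : ℕ) → Stage (L m) (bound m)

      bound zero    = 0
      bound (suc m) = suc (max (bound m) (toList (Stage.indices (stages m))))

      stages m = stage (L m) (x₀ m) (bound m)

      words : ℕ → Sn n
      words = Stage.word ∘ stages

      indices : ℕ → List ℕ
      indices = toList ∘ Stage.indices ∘ stages

      indices-increasing : ∀ {G} → Linked _<_ G → Linked _<_ (concat (map indices G))
      indices-increasing = concat-blocks-increasing indices bound
        (λ m → ≤-trans (⊥≤max (bound m) (indices m)) (n≤1+n _))
        (Stage.increasing ∘ stages)
        (Stage.above ∘ stages)
        (λ m → All.map s≤s (xs≤max (bound m) (indices m)))

      τ-words : (G : List ℕ) →
        concat (map (τ k ∘ words) G) ≡ concat (map (proj₁ ∘ y) (concat (map indices G)))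
      τ-words G = begin
        concat (map (τ k ∘ words) G)
          ≡⟨ cong concat (List.map-cong (Stage.τ-word ∘ stages) G) ⟩
        concat (map (concat ∘ map Y ∘ indices) G)
          ≡⟨ cong concat (List.map-∘ G) ⟩
        concat (map concat (map (map Y ∘ indices) G))
          ≡⟨ List.concat-concat (map (map Y ∘ indices) G) ⟩
        concat (concat (map (map Y ∘ indices) G))
          ≡⟨ cong (concat ∘ concat) (List.map-∘ G) ⟩
        concat (concat (map (map Y) (map indices G)))
          ≡⟨ cong concat (List.concat-map (map indices G)) ⟩
        concat (map Y (concat (map indices G))) ∎
        where
        open ≡-Reasoning
        Y : ℕ → List (Fin k)
        Y = proj₁ ∘ y

      τ-words-FP : (G : List⁺ ℕ) → Linked _<_ (toList G) → FP y (concat (map (τ k ∘ words) (toList G)))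
      τ-words-FP (g ∷ gs) G↑ =
        Stage.indices (stages g) ⁺++ concat (map indices gs) , indices-increasing G↑ , τ-words (g ∷ gs)

mainTheorem8 : (Alph : Set) (alph : ℕ → List Alph) →
    ((m : ℕ) → Σ Alph (λ a → a ∈ alph m)) →
    ((m : ℕ) (a : Alph) → a ∈ alph m → a ∈ alph (suc m)) →
    ((a : Alph) → Σ ℕ (λ m → a ∈ alph m)) →
    (k n : ℕ) → k < n →
    (y : ℕ → Words.T Alph k) →
    (C : Words.S₀ Alph → Set) →
    SemigroupNotions.CSet (_⁺++⁺_ {A = Alph}) C →
    Σ (ℕ → Words.Sn Alph n) λ w →
    ((m : ℕ) (a : Fin n → Alph) → ((i : Fin n) → a i ∈ alph m) →
    C (Words.subst Alph (w m) a))
    ×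
    ((G : List⁺ ℕ) → Linked _<_ (toList G) →
    Words.FP Alph y (concat (map (λ m → Words.τ Alph k (w m)) (toList G))))
mainTheorem8 Alph alph inhabited _ _ k n k<n y C (_ , _ , p∈J , C∈p) =
  words , Stage.word-in-C ∘ stages , τ-words-FP
  where
  open Construction Alph k<n y
  open Stages C (p∈J C C∈p)
  open Sequence alph (proj₁ ∘ inhabited)
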